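{- Let $r\ge 1$ and let $n\ge 4$ be even. Let $rC_n$ denote the disjoint union of $r$ copies of the cycle $C_n$ of length $n$. Then $rC_n$ is local antimagic and $\chi_{la}(rC_n)=3$.
   Context: For a graph $G=(V,E)$ without $K_2$ components, a bijection $f:E\to\{1,2,\dots,|E|\}$ induces the weight $w(u)=\sum_{uv\in E} f(uv)$ of each vertex $u$. The bijection $f$ is a local antimagic labeling if $w(u)\neq w(v)$ for every edge $uv$; a graph admitting one is local antimagic. The local antimagic chromatic number $\chi_{la}(G)$ is the minimum number of distinct weights over all local antimagic labelings of $G$. -}

module Defs where

open import Data.Nat using (ℕ; zero; suc; _+_; _*_; _≤_)
open import Data.Nat.DivMod using (_mod_)
open import Data.Fin using (Fin; toℕ; combine; remQuot)
open import Data.Fin.Properties using () renaming (_≟_ to _≟ᶠ_)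
open import Data.Nat.Properties using (_≟_)
open import Data.Bool using (Bool; true; false; if_then_else_; _∨_)
open import Data.Nat.ListAction using (sum)
open import Data.List using (List; map; allFin; length; deduplicate)
open import Data.Product using (_×_; _,_; proj₁; proj₂; Σ-syntax; ∃-syntax)
open import Function.Bundles using (_⤖_; Bijection)
open import Relation.Nullary.Decidable using (⌊_⌋)
open import Relation.Binary.PropositionalEquality using (_≡_; _≢_)

record Graph : Set where
  field
    V    : ℕ
    E    : ℕ
    ends : Fin E → Fin V × Fin V
open Graph public

-- An edge labeling: a bijection E → {1,…,|E|}, encoded as a bijection
-- Fin E ⤖ Fin E; edge e gets label 1 + toℕ (f e).
Labeling : Graph → Set
Labeling G = Fin (E G) ⤖ Fin (E G)

label : (G : Graph) → Labeling G → Fin (E G) → ℕ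
label G f e = suc (toℕ (Bijection.to f e))

incident : (G : Graph) → Fin (V G) → Fin (E G) → Bool
incident G u e = ⌊ u ≟ᶠ proj₁ (ends G e) ⌋ ∨ ⌊ u ≟ᶠ proj₂ (ends G e) ⌋

weight : (G : Graph) → Labeling G → Fin (V G) → ℕ
weight G f u = sum (map (λ e → if incident G u e then label G f e else 0) (allFin (E G)))

IsLocalAntimagic : (G : Graph) → Labeling G → Set
IsLocalAntimagic G f = (e : Fin (E G)) →
  weight G f (proj₁ (ends G e)) ≢ weight G f (proj₂ (ends G e))

LocalAntimagic : Graph → Set
LocalAntimagic G = ∃[ f ] IsLocalAntimagic G f

numWeights : (G : Graph) → Labeling G → ℕ
numWeights G f = length (deduplicate _≟_ (map (weight G f) (allFin (V G))))

ChiLa≡ : Graph → ℕ → Set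
ChiLa≡ G k =
  (∃[ f ] (IsLocalAntimagic G f × numWeights G f ≡ k)) ×
  ((f : Labeling G) → IsLocalAntimagic G f → k ≤ numWeights G f)

cycNext : ∀ {n} → Fin n → Fin n
cycNext {suc m} j = suc (toℕ j) mod (suc m)

-- r C_n : vertices Fin (r * n) ≅ Fin r × Fin n (copy i, position j) via combine;
-- edge e = (i , j) joins (i , j) and (i , j+1 mod n).
rC : ℕ → ℕ → Graph
rC r n = record
  { V = r * n
  ; E = r * n
  ; ends = λ e → let (i , j) = remQuot {r} n e in combine i j , combine i (cycNext j)
  }

-- Number the edges of rCₙ copy by copy as 0, …, m − 1 (m = rn) and give the even edges the
-- labels 1, 2, … and the odd edges the labels m, m − 1, … .  Then inside a copy the vertex
-- between edges x and x + 1 has weight m + 1 for x even and m + 2 for x odd, while the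
-- first vertex of every copy has weight m + 2 − n/2; this is a local antimagic labeling
-- with three weights.  Conversely, two weights would have to alternate around a copy of
-- Cₙ; since n is even, the n/2 weights at the even positions and the n/2 weights at the
-- odd positions both add up to the total label of that copy, so the two weights coincide.
module Submission where

open import Defs
open import Data.Nat
  using (ℕ; zero; suc; _+_; _*_; _∸_; _≤_; _<_; _≤?_; _<?_; z≤n; s≤s; z<s; NonZero)
open import Data.Nat.Properties hiding (suc-injective)
open import Data.Nat.DivMod
  using (_mod_; _%_; n%n≡0; m%n%n≡m%n; %-distribˡ-+; m*n%n≡0; [m+kn]%n≡m%n; m%n<n; m<n⇒m%n≡m)
open import Data.Nat.Divisibility using (_∣_; divides)
open import Data.Nat.ListAction using (sum)
open import Data.Nat.Tactic.RingSolver using (solve-∀)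
open import Data.Fin using (Fin; zero; suc; toℕ; fromℕ; fromℕ<; inject₁; lower₁; combine)
open import Data.Fin.Properties
  using ( toℕ-fromℕ<; toℕ-fromℕ; toℕ-inject₁; toℕ-injective; toℕ<n; suc-injective
        ; inject₁-lower₁; remQuot-combine; combine-injective; combine-injectiveʳ
        ; combine-surjective; toℕ-combine)
  renaming (_≟_ to _≟ᶠ_)
open import Data.Bool using (true; false; if_then_else_)
open import Data.List using (List; []; _∷_; map; allFin; length; deduplicate; tabulate)
open import Data.List.Properties using (map-tabulate; filter-notAll)
open import Data.List.Membership.Propositional using (_∈_)
open import Data.List.Membership.Propositional.Properties
  using (∈-filter⁺; ∈-deduplicate⁺; ∈-deduplicate⁻; ∈-map⁺; ∈-map⁻; ∈-allFin)
open import Data.List.Relation.Unary.Any using (here; there)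
import Data.List.Relation.Unary.Any as Any
import Data.List.Relation.Unary.All as All
open import Data.List.Relation.Unary.AllPairs using (_∷_)
open import Data.List.Relation.Unary.Unique.Propositional using (Unique)
open import Data.List.Relation.Unary.Unique.DecPropositional.Properties _≟_ using (deduplicate-!)
open import Data.List.Relation.Binary.Subset.Propositional using (_⊆_)
open import Data.Product using (_×_; _,_; proj₁; proj₂; ∃₂)
open import Data.Sum using (_⊎_; inj₁; inj₂; [_,_])
open import Data.Empty using (⊥; ⊥-elim)
open import Function using (_∘_)
open import Function.Bundles using (_⤖_; Bijection; mk↔ₛ′)
open import Function.Properties.Inverse using (↔⇒⤖)
open import Relation.Nullary using (¬_; yes; no; ¬?)
open import Relation.Binary.PropositionalEquality hiding ([_])

m∸[1+[m∸[1+n]]]≡n : ∀ {m n} → n < m → m ∸ suc (m ∸ suc n) ≡ n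
m∸[1+[m∸[1+n]]]≡n (s≤s n≤m) = m∸[m∸n]≡n n≤m

m*2≡m+m : ∀ m → m * 2 ≡ m + m
m*2≡m+m m = trans (*-comm m 2) (cong (m +_) (+-identityʳ m))

1+n≤m⇐1+n*2≤m : ∀ {m} n → suc (n * 2) ≤ m → suc n ≤ m
1+n≤m⇐1+n*2≤m n = ≤-trans (s≤s (m≤m*n n 2))

data ParityView : ℕ → Set where
  even : ∀ t → ParityView (t * 2)
  odd  : ∀ t → ParityView (suc (t * 2))

parityView : ∀ x → ParityView x
parityView zero = even 0
parityView (suc x) with parityView x
... | even t = odd t
... | odd t  = even (suc t)

parityView-even : ∀ t → parityView (t * 2) ≡ even t
parityView-even zero    = refl
parityView-even (suc t) rewrite parityView-even t = refl

parityView-odd : ∀ t → parityView (suc (t * 2)) ≡ odd t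
parityView-odd t rewrite parityView-even t = refl

[1+n*2]%2≡1 : ∀ n → suc (n * 2) % 2 ≡ 1
[1+n*2]%2≡1 n = [m+kn]%n≡m%n 1 n 2

n%2≢[1+n]%2 : ∀ n → n % 2 ≢ suc n % 2
n%2≢[1+n]%2 n with parityView n
... | even t = λ eq → 0≢1+n (trans (sym (m*n%n≡0 t 2)) (trans eq ([1+n*2]%2≡1 t)))
... | odd t  = λ eq → 1+n≢0 (trans (sym ([1+n*2]%2≡1 t)) (trans eq (m*n%n≡0 (suc t) 2)))

[1+[m%n]]%n≡[1+m]%n : ∀ m n .{{_ : NonZero n}} → suc (m % n) % n ≡ suc m % n
[1+[m%n]]%n≡[1+m]%n m n = begin
  (1 + m % n) % n           ≡⟨ %-distribˡ-+ 1 (m % n) n ⟩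
  (1 % n + m % n % n) % n   ≡⟨ cong (λ z → (1 % n + z) % n) (m%n%n≡m%n m n) ⟩
  (1 % n + m % n) % n       ≡⟨ %-distribˡ-+ 1 m n ⟨
  (1 + m) % n               ∎
  where open ≡-Reasoning

sum< : ℕ → (ℕ → ℕ) → ℕ
sum< zero    h = 0
sum< (suc n) h = sum< n h + h n

≢-chain-in-pair : ∀ {p q a b c : ℕ} → a ≡ p ⊎ a ≡ q → b ≡ p ⊎ b ≡ q → c ≡ p ⊎ c ≡ q →
                  a ≢ b → b ≢ c → c ≡ a
≢-chain-in-pair (inj₁ refl) (inj₁ refl) _           a≢b _   = ⊥-elim (a≢b refl)
≢-chain-in-pair (inj₂ refl) (inj₂ refl) _           a≢b _   = ⊥-elim (a≢b refl)
≢-chain-in-pair _           (inj₁ refl) (inj₁ refl) _   b≢c = ⊥-elim (b≢c refl)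
≢-chain-in-pair _           (inj₂ refl) (inj₂ refl) _   b≢c = ⊥-elim (b≢c refl)
≢-chain-in-pair (inj₁ refl) (inj₂ refl) (inj₁ refl) _   _   = refl
≢-chain-in-pair (inj₂ refl) (inj₁ refl) (inj₂ refl) _   _   = refl

two-valued-proper⇒2-periodic : ∀ {ω : ℕ → ℕ} {p q} → (∀ x → ω x ≡ p ⊎ ω x ≡ q) →
                               (∀ x → ω x ≢ ω (suc x)) → ∀ x → ω (suc (suc x)) ≡ ω x
two-valued-proper⇒2-periodic two-valued proper x =
  ≢-chain-in-pair (two-valued x) (two-valued (suc x)) (two-valued (suc (suc x))) (proper x) (proper (suc x))

-- h and ω are the edge labels and vertex weights read along a closed walk of length k * 2.
module _ (h ω : ℕ → ℕ)
         (ω-suc : ∀ x → ω (suc x) ≡ h (suc x) + h x)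
         (proper : ∀ x → ω x ≢ ω (suc x)) where

  no-proper-two-valued-weighting : ∀ k .{{_ : NonZero k}} → h (k * 2) ≡ h 0 →
                                   ¬ (∃₂ λ p q → ∀ x → ω x ≡ p ⊎ ω x ≡ q)
  no-proper-two-valued-weighting k h-closed (p , q , two-valued) =
    proper 0 (*-cancelˡ-≡ (ω 0) (ω 1) k (+-cancelʳ-≡ (h 0) _ _ (begin
      k * ω 0 + h 0             ≡⟨ even-sum k ⟩
      h (k * 2) + sum< (k * 2) h ≡⟨ cong (_+ sum< (k * 2) h) h-closed ⟩
      h 0 + sum< (k * 2) h      ≡⟨ +-comm (h 0) _ ⟩
      sum< (k * 2) h + h 0      ≡⟨ cong (_+ h 0) (odd-sum k) ⟨
      k * ω 1 + h 0             ∎)))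
    where
    open ≡-Reasoning

    reverse₃ : ∀ a b c → (a + b) + c ≡ c + b + a
    reverse₃ = solve-∀

    reverse₃ʳ : ∀ a b c d → (a + b) + (c + d) ≡ a + (d + c + b)
    reverse₃ʳ = solve-∀

    2-periodic : ∀ x → ω (suc (suc x)) ≡ ω x
    2-periodic = two-valued-proper⇒2-periodic two-valued proper

    ω-even : ∀ t → ω (t * 2) ≡ ω 0
    ω-even zero    = refl
    ω-even (suc t) = trans (2-periodic (t * 2)) (ω-even t)

    ω-odd : ∀ t → ω (suc (t * 2)) ≡ ω 1
    ω-odd zero    = refl
    ω-odd (suc t) = trans (2-periodic (suc (t * 2))) (ω-odd t)

    odd-sum : ∀ t → t * ω 1 ≡ sum< (t * 2) h
    odd-sum zero    = refl
    odd-sum (suc t) = begin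
      ω 1 + t * ω 1
        ≡⟨ cong₂ _+_ (trans (sym (ω-odd t)) (ω-suc (t * 2))) (odd-sum t) ⟩
      (h (suc (t * 2)) + h (t * 2)) + sum< (t * 2) h
        ≡⟨ reverse₃ (h (suc (t * 2))) (h (t * 2)) (sum< (t * 2) h) ⟩
      sum< (t * 2) h + h (t * 2) + h (suc (t * 2)) ∎

    even-sum : ∀ t → t * ω 0 + h 0 ≡ h (t * 2) + sum< (t * 2) h
    even-sum zero    = sym (+-identityʳ (h 0))
    even-sum (suc t) = begin
      (ω 0 + t * ω 0) + h 0
        ≡⟨ +-assoc (ω 0) _ _ ⟩
      ω 0 + (t * ω 0 + h 0)
        ≡⟨ cong₂ _+_ (trans (sym (ω-even (suc t))) (ω-suc (suc (t * 2)))) (even-sum t) ⟩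
      (h (suc t * 2) + h (suc (t * 2))) + (h (t * 2) + sum< (t * 2) h)
        ≡⟨ reverse₃ʳ (h (suc t * 2)) (h (suc (t * 2))) (h (t * 2)) (sum< (t * 2) h) ⟩
      h (suc t * 2) + (sum< (t * 2) h + h (t * 2) + h (suc (t * 2))) ∎

sum-tabulate-zero : ∀ {N} (h : Fin N → ℕ) → (∀ e → h e ≡ 0) → sum (tabulate h) ≡ 0
sum-tabulate-zero {zero}  h h≡0 = refl
sum-tabulate-zero {suc N} h h≡0 rewrite h≡0 zero = sum-tabulate-zero (h ∘ suc) (h≡0 ∘ suc)

sum-tabulate-single : ∀ {N} (h : Fin N → ℕ) a → (∀ e → e ≢ a → h e ≡ 0) → sum (tabulate h) ≡ h a
sum-tabulate-single h zero    h≡0 =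
  trans (cong (h zero +_) (sum-tabulate-zero (h ∘ suc) (λ e → h≡0 (suc e) λ ()))) (+-identityʳ _)
sum-tabulate-single h (suc a) h≡0 rewrite h≡0 zero (λ ()) =
  sum-tabulate-single (h ∘ suc) a (λ e e≢a → h≡0 (suc e) (e≢a ∘ suc-injective))

sum-tabulate-pair : ∀ {N} (h : Fin N → ℕ) {a b} → a ≢ b → (∀ e → e ≢ a → e ≢ b → h e ≡ 0) →
                    sum (tabulate h) ≡ h a + h b
sum-tabulate-pair h {zero}  {zero}  a≢b _   = ⊥-elim (a≢b refl)
sum-tabulate-pair h {zero}  {suc b} _   h≡0 =
  cong (h zero +_) (sum-tabulate-single (h ∘ suc) b (λ e e≢b → h≡0 (suc e) (λ ()) (e≢b ∘ suc-injective)))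
sum-tabulate-pair h {suc a} {zero}  _   h≡0 =
  trans (cong (h zero +_) (sum-tabulate-single (h ∘ suc) a
           (λ e e≢a → h≡0 (suc e) (e≢a ∘ suc-injective) (λ ()))))
        (+-comm (h zero) _)
sum-tabulate-pair h {suc a} {suc b} a≢b h≡0 rewrite h≡0 zero (λ ()) (λ ()) =
  sum-tabulate-pair (h ∘ suc) (a≢b ∘ cong suc)
    (λ e e≢a e≢b → h≡0 (suc e) (e≢a ∘ suc-injective) (e≢b ∘ suc-injective))

module _ (G : Graph) where

  incident-sound : ∀ {u e} → incident G u e ≡ true → u ≡ proj₁ (ends G e) ⊎ u ≡ proj₂ (ends G e)
  incident-sound {u} {e} _  with u ≟ᶠ proj₁ (ends G e) | u ≟ᶠ proj₂ (ends G e)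
  incident-sound         _  | yes u≡x | _       = inj₁ u≡x
  incident-sound         _  | no _    | yes u≡y = inj₂ u≡y
  incident-sound         () | no _    | no _

  incident-complete : ∀ {u e} → u ≡ proj₁ (ends G e) ⊎ u ≡ proj₂ (ends G e) → incident G u e ≡ true
  incident-complete {u} {e} u∈e with u ≟ᶠ proj₁ (ends G e) | u ≟ᶠ proj₂ (ends G e)
  ... | yes _ | _     = refl
  ... | no _  | yes _ = refl
  ... | no u≢x | no u≢y = ⊥-elim ([ u≢x , u≢y ] u∈e)

  weight-of-degree-two : ∀ (f : Labeling G) {u a b} → a ≢ b →
    incident G u a ≡ true → incident G u b ≡ true →
    (∀ e → incident G u e ≡ true → e ≡ a ⊎ e ≡ b) →
    weight G f u ≡ label G f a + label G f b
  weight-of-degree-two f {u} {a} {b} a≢b u∈a u∈b only-a-b = begin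
    sum (map g (allFin (E G)))  ≡⟨ cong sum (map-tabulate (λ e → e) g) ⟩
    sum (tabulate g)            ≡⟨ sum-tabulate-pair g a≢b g≡0 ⟩
    g a + g b                   ≡⟨ cong₂ _+_ (g-incident u∈a) (g-incident u∈b) ⟩
    label G f a + label G f b   ∎
    where
    open ≡-Reasoning
    g : Fin (E G) → ℕ
    g e = if incident G u e then label G f e else 0

    g-incident : ∀ {e} → incident G u e ≡ true → g e ≡ label G f e
    g-incident u∈e rewrite u∈e = refl

    g≡0 : ∀ e → e ≢ a → e ≢ b → g e ≡ 0
    g≡0 e e≢a e≢b with incident G u e in u∈e
    ... | false = refl
    ... | true  = ⊥-elim ([ e≢a , e≢b ] (only-a-b e u∈e))

Unique-⊆⇒length≤ : ∀ {xs ys : List ℕ} → Unique xs → xs ⊆ ys → length xs ≤ length ys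
Unique-⊆⇒length≤ {[]}     _              _     = z≤n
Unique-⊆⇒length≤ {x ∷ xs} {ys} (x∉xs ∷ u) xs⊆ys =
  ≤-trans (s≤s (Unique-⊆⇒length≤ u λ y∈xs → ∈-filter⁺ x≢? (xs⊆ys (there y∈xs)) (x≢y y∈xs)))
          (filter-notAll x≢? ys (Any.map (λ x≡y x≢y → x≢y x≡y) (xs⊆ys (here refl))))
  where
  x≢? = λ y → ¬? (x ≟ y)
  x≢y : ∀ {y} → y ∈ xs → x ≢ y
  x≢y y∈xs = All.lookup x∉xs y∈xs

length≤2⇒two-values : ∀ (xs : List ℕ) → length xs ≤ 2 →
                      ∃₂ λ p q → ∀ {x} → x ∈ xs → x ≡ p ⊎ x ≡ q
length≤2⇒two-values []          _ = 0 , 0 , λ ()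
length≤2⇒two-values (p ∷ [])     _ = p , p , λ { (here x≡p) → inj₁ x≡p }
length≤2⇒two-values (p ∷ q ∷ []) _ =
  p , q , λ { (here x≡p) → inj₁ x≡p ; (there (here x≡q)) → inj₂ x≡q }
length≤2⇒two-values (_ ∷ _ ∷ _ ∷ _) (s≤s (s≤s ()))

module _ (G : Graph) (f : Labeling G) where

  private
    weights : List ℕ
    weights = map (weight G f) (allFin (V G))

  numWeights≤length : ∀ (ws : List ℕ) → (∀ v → weight G f v ∈ ws) → numWeights G f ≤ length ws
  numWeights≤length ws w∈ws = Unique-⊆⇒length≤ (deduplicate-! weights) λ x∈ →
    let v , _ , x≡wv = ∈-map⁻ (weight G f) (∈-deduplicate⁻ _≟_ weights x∈) in
    subst (_∈ ws) (sym x≡wv) (w∈ws v)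

  numWeights≤2⇒two-valued : numWeights G f ≤ 2 →
                            ∃₂ λ p q → ∀ v → weight G f v ≡ p ⊎ weight G f v ≡ q
  numWeights≤2⇒two-valued ≤2 =
    let p , q , two = length≤2⇒two-values _ ≤2 in
    p , q , λ v → two (∈-deduplicate⁺ _≟_ (∈-map⁺ (weight G f) (∈-allFin v)))

prev : ∀ {n} → Fin (suc n) → Fin (suc n)
prev {n} zero = fromℕ n
prev (suc j)  = inject₁ j

mod-cong : ∀ {x y n} .{{_ : NonZero n}} → x % n ≡ y % n → x mod n ≡ y mod n
mod-cong {x} {y} {n} eq = toℕ-injective (begin
  toℕ (x mod n) ≡⟨ toℕ-fromℕ< _ ⟩
  x % n         ≡⟨ eq ⟩
  y % n         ≡⟨ toℕ-fromℕ< _ ⟨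
  toℕ (y mod n) ∎)
  where open ≡-Reasoning

cycNext-mod : ∀ x n .{{_ : NonZero n}} → cycNext (x mod n) ≡ suc x mod n
cycNext-mod x n@(suc _) = mod-cong {suc (toℕ (x mod n))} {suc x}
  (trans (cong (λ z → suc z % n) (toℕ-fromℕ< _)) ([1+[m%n]]%n≡[1+m]%n x n))

cycNext-prev : ∀ {n} (j : Fin (suc n)) → cycNext (prev j) ≡ j
cycNext-prev {n} zero = mod-cong {suc (toℕ (fromℕ n))} {0}
  (trans (cong (λ z → suc z % suc n) (toℕ-fromℕ n)) (n%n≡0 (suc n)))
cycNext-prev {n} (suc j) = toℕ-injective (begin
  toℕ (suc (toℕ (inject₁ j)) mod suc n) ≡⟨ toℕ-fromℕ< _ ⟩
  suc (toℕ (inject₁ j)) % suc n         ≡⟨ cong (λ z → suc z % suc n) (toℕ-inject₁ j) ⟩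
  suc (toℕ j) % suc n                   ≡⟨ m<n⇒m%n≡m (s≤s (toℕ<n j)) ⟩
  suc (toℕ j)                           ∎)
  where open ≡-Reasoning

prev-cycNext : ∀ {n} (j : Fin (suc n)) → prev (cycNext j) ≡ j
prev-cycNext {n} j with n ≟ toℕ j
... | yes n≡j = subst (λ j → prev (cycNext j) ≡ j) (toℕ-injective (trans (toℕ-fromℕ n) n≡j))
                      (cong prev (cycNext-prev zero))
... | no n≢j  = subst (λ j → prev (cycNext j) ≡ j) (inject₁-lower₁ j n≢j)
                      (cong prev (cycNext-prev (suc (lower₁ j n≢j))))

prev≢ : ∀ {n} (j : Fin (suc (suc n))) → j ≢ prev j
prev≢ {n} zero    j≡prev = 0≢1+n (trans (cong toℕ j≡prev) (toℕ-fromℕ (suc n)))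
prev≢     (suc j) j≡prev = 1+n≢n (trans (cong toℕ j≡prev) (toℕ-inject₁ j))

ends-rC : ∀ {r n} (i : Fin r) (j : Fin n) →
          ends (rC r n) (combine i j) ≡ (combine i j , combine i (cycNext j))
ends-rC {r} {n} i j = cong (λ (i , j) → combine i j , combine i (cycNext j)) (remQuot-combine {r} {n} i j)

module _ {r n : ℕ} where

  private
    G : Graph
    G = rC r (suc (suc n))

  incident-rC : ∀ {i : Fin r} {j : Fin (suc (suc n))} {e} → incident G (combine i j) e ≡ true →
                e ≡ combine i j ⊎ e ≡ combine i (prev j)
  incident-rC {i} {j} {e} ij∈e with combine-surjective {r} {suc (suc n)} e
  ... | i′ , j′ , refl
    with subst (λ (x , y) → combine i j ≡ x ⊎ combine i j ≡ y) (ends-rC i′ j′) (incident-sound G ij∈e)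
  ... | inj₁ ij≡i′j′ = inj₁ (sym ij≡i′j′)
  ... | inj₂ ij≡i′j′⁺ with combine-injective i j i′ (cycNext j′) ij≡i′j′⁺
  ...   | refl , refl = inj₂ (cong (combine i) (sym (prev-cycNext j′)))

  weight-rC : ∀ (f : Labeling G) (i : Fin r) (j : Fin (suc (suc n))) →
              weight G f (combine i j) ≡ label G f (combine i j) + label G f (combine i (prev j))
  weight-rC f i j = weight-of-degree-two G f {combine i j} {combine i j} {combine i (prev j)}
    (prev≢ j ∘ combine-injectiveʳ i j i (prev j))
    (incident-complete G (inj₁ (sym (cong proj₁ (ends-rC i j)))))
    (incident-complete G (inj₂ (sym (trans (cong proj₂ (ends-rC i (prev j)))
                                           (cong (combine i) (cycNext-prev j))))))
    (λ e → incident-rC)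

-- At least three weights

module _ (r k : ℕ) (f : Labeling (rC (suc r) (suc k * 2))) where

  private
    n : ℕ
    n = suc k * 2

    G : Graph
    G = rC (suc r) n

    copy₀ : Fin (suc r)
    copy₀ = zero

    h ω : ℕ → ℕ
    h x = label G f (combine copy₀ (x mod n))
    ω x = weight G f (combine copy₀ (x mod n))

    ω-suc : ∀ x → ω (suc x) ≡ h (suc x) + h x
    ω-suc x = begin
      weight G f (combine copy₀ (suc x mod n))
        ≡⟨ weight-rC f copy₀ (suc x mod n) ⟩
      h (suc x) + label G f (combine copy₀ (prev (suc x mod n)))
        ≡⟨ cong (λ j → h (suc x) + label G f (combine copy₀ (prev j))) (cycNext-mod x n) ⟨
      h (suc x) + label G f (combine copy₀ (prev (cycNext (x mod n))))
        ≡⟨ cong (λ j → h (suc x) + label G f (combine copy₀ j)) (prev-cycNext (x mod n)) ⟩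
      h (suc x) + h x ∎
      where open ≡-Reasoning

    ω-proper : IsLocalAntimagic G f → ∀ x → ω x ≢ ω (suc x)
    ω-proper antimagic x ωx≡ωx⁺ = antimagic (combine copy₀ (x mod n)) (begin
      weight G f (proj₁ (ends G (combine copy₀ (x mod n))))
        ≡⟨ cong (weight G f ∘ proj₁) (ends-rC copy₀ (x mod n)) ⟩
      ω x
        ≡⟨ ωx≡ωx⁺ ⟩
      ω (suc x)
        ≡⟨ cong (weight G f ∘ combine copy₀) (cycNext-mod x n) ⟨
      weight G f (combine copy₀ (cycNext (x mod n)))
        ≡⟨ cong (weight G f ∘ proj₂) (ends-rC copy₀ (x mod n)) ⟨
      weight G f (proj₂ (ends G (combine copy₀ (x mod n))))  ∎)
      where open ≡-Reasoning

    h-closed : h n ≡ h 0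
    h-closed = cong (label G f ∘ combine copy₀) (mod-cong {n} {0} (n%n≡0 n))

  3≤numWeights-rC : IsLocalAntimagic G f → 3 ≤ numWeights G f
  3≤numWeights-rC antimagic with numWeights G f ≤? 2
  ... | no ≰2 = ≰⇒> ≰2
  ... | yes ≤2 =
    let p , q , two-valued = numWeights≤2⇒two-valued G f ≤2 in
    ⊥-elim (no-proper-two-valued-weighting h ω ω-suc (ω-proper antimagic) (suc k) h-closed
              (p , q , λ x → two-valued (combine copy₀ (x mod n))))

-- The zigzag labeling

module _ {m : ℕ} where

  restrict : (σ : ℕ → ℕ) → (∀ {x} → x < m → σ x < m) → Fin m → Fin m
  restrict σ σ< i = fromℕ< (σ< (toℕ<n i))

  toℕ-restrict : ∀ σ (σ< : ∀ {x} → x < m → σ x < m) i → toℕ (restrict σ σ< i) ≡ σ (toℕ i)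
  toℕ-restrict σ σ< i = toℕ-fromℕ< _

  restrict-⤖ : ∀ {σ τ : ℕ → ℕ} (σ< : ∀ {x} → x < m → σ x < m) (τ< : ∀ {y} → y < m → τ y < m) →
               (∀ {y} → y < m → σ (τ y) ≡ y) → (∀ {x} → x < m → τ (σ x) ≡ x) → Fin m ⤖ Fin m
  restrict-⤖ {σ} {τ} σ< τ< σ∘τ τ∘σ =
    ↔⇒⤖ (mk↔ₛ′ (restrict σ σ<) (restrict τ τ<) (inverse σ∘τ σ< τ<) (inverse τ∘σ τ< σ<))
    where
    inverse : ∀ {f g} → (∀ {y} → y < m → f (g y) ≡ y) →
              (f< : ∀ {x} → x < m → f x < m) (g< : ∀ {y} → y < m → g y < m) →
              ∀ y → restrict f f< (restrict g g< y) ≡ y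
    inverse {f} {g} f∘g f< g< y = toℕ-injective (begin
      toℕ (restrict f f< (restrict g g< y)) ≡⟨ toℕ-restrict f f< _ ⟩
      f (toℕ (restrict g g< y))             ≡⟨ cong f (toℕ-restrict g g< y) ⟩
      f (g (toℕ y))                         ≡⟨ f∘g (toℕ<n y) ⟩
      toℕ y                                 ∎)
      where open ≡-Reasoning

module Zigzag (m M : ℕ) (m≡M*2 : m ≡ M * 2) where

  zig : ∀ {x} → ParityView x → ℕ
  zig (even t) = t
  zig (odd t)  = m ∸ suc t

  σ : ℕ → ℕ
  σ x = zig (parityView x)

  σ-even : ∀ t → σ (t * 2) ≡ t
  σ-even t rewrite parityView-even t = refl

  σ-odd : ∀ t → σ (suc (t * 2)) ≡ m ∸ suc t
  σ-odd t rewrite parityView-odd t = refl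

  τ : ℕ → ℕ
  τ y with y <? M
  ... | yes _ = y * 2
  ... | no _  = suc ((m ∸ suc y) * 2)

  <M⇒1+[*2]<m : ∀ {t} → t < M → suc (t * 2) < m
  <M⇒1+[*2]<m t<M = subst (_ <_) (sym m≡M*2) (*-monoˡ-≤ 2 t<M)

  *2<m⇒<M : ∀ {t} → t * 2 < m → t < M
  *2<m⇒<M {t} t*2<m = *-cancelʳ-< 2 t M (subst (t * 2 <_) m≡M*2 t*2<m)

  m∸M≡M : m ∸ M ≡ M
  m∸M≡M = trans (cong (_∸ M) (trans m≡M*2 (m*2≡m+m M))) (m+n∸n≡m M M)

  M≤m∸[1+t] : ∀ {t} → t < M → M ≤ m ∸ suc t
  M≤m∸[1+t] {t} t<M = subst (_≤ m ∸ suc t) m∸M≡M (∸-monoʳ-≤ m t<M)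

  m∸[1+y]<M : ∀ {y} → M ≤ y → y < m → m ∸ suc y < M
  m∸[1+y]<M {y} M≤y y<m = +-cancelʳ-< M _ _ (begin-strict
    m ∸ suc y + M      <⟨ +-monoʳ-< (m ∸ suc y) (s≤s M≤y) ⟩
    m ∸ suc y + suc y  ≡⟨ m∸n+n≡m y<m ⟩
    m                  ≡⟨ trans m≡M*2 (m*2≡m+m M) ⟩
    M + M              ∎)
    where open ≤-Reasoning

  σ< : ∀ {x} → x < m → σ x < m
  σ< {x} x<m with parityView x
  ... | even t = ≤-<-trans (m≤m*n t 2) x<m
  ... | odd t  = ∸-monoʳ-< z<s (1+n≤m⇐1+n*2≤m t (<⇒≤ x<m))

  τ< : ∀ {y} → y < m → τ y < m
  τ< {y} y<m with y <? M
  ... | yes y<M = <-trans (n<1+n _) (<M⇒1+[*2]<m y<M)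
  ... | no y≮M  = <M⇒1+[*2]<m (m∸[1+y]<M (≮⇒≥ y≮M) y<m)

  σ∘τ : ∀ {y} → y < m → σ (τ y) ≡ y
  σ∘τ {y} y<m with y <? M
  ... | yes _ = σ-even y
  ... | no _  = trans (σ-odd (m ∸ suc y)) (m∸[1+[m∸[1+n]]]≡n y<m)

  τ∘σ : ∀ {x} → x < m → τ (σ x) ≡ x
  τ∘σ {x} x<m with parityView x
  ... | even t with t <? M
  ...   | yes _   = refl
  ...   | no t≮M = ⊥-elim (t≮M (*2<m⇒<M x<m))
  τ∘σ {x} x<m | odd t with m ∸ suc t <? M
  ...   | yes m∸[1+t]<M = ⊥-elim (<⇒≱ m∸[1+t]<M (M≤m∸[1+t] (*2<m⇒<M (<-trans (n<1+n _) x<m))))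
  ...   | no _          = cong (λ u → suc (u * 2)) (m∸[1+[m∸[1+n]]]≡n (1+n≤m⇐1+n*2≤m t (<⇒≤ x<m)))

  zigzag : Fin m ⤖ Fin m
  zigzag = restrict-⤖ σ< τ< σ∘τ τ∘σ

  ℓ : ℕ → ℕ
  ℓ x = suc (σ x)

  ℓ-zigzag : ∀ e → suc (toℕ (Bijection.to zigzag e)) ≡ ℓ (toℕ e)
  ℓ-zigzag e = cong suc (toℕ-restrict σ σ< e)

  ℓ-consecutive : ∀ x → suc x < m → ℓ (suc x) + ℓ x ≡ x % 2 + suc m
  ℓ-consecutive x = by-parity (parityView x)
    where
    by-parity : ∀ {x} → ParityView x → suc x < m → ℓ (suc x) + ℓ x ≡ x % 2 + suc m
    by-parity (even t) x⁺<m = begin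
      ℓ (suc (t * 2)) + ℓ (t * 2)  ≡⟨ cong₂ (λ a b → suc a + suc b) (σ-odd t) (σ-even t) ⟩
      suc (m ∸ suc t) + suc t      ≡⟨ cong suc (m∸n+n≡m (1+n≤m⇐1+n*2≤m t (<⇒≤ x⁺<m))) ⟩
      suc m                        ≡⟨ cong (_+ suc m) (m*n%n≡0 t 2) ⟨
      t * 2 % 2 + suc m            ∎
      where open ≡-Reasoning
    by-parity (odd t) x⁺<m = begin
      ℓ (suc t * 2) + ℓ (suc (t * 2))  ≡⟨ cong₂ (λ a b → suc a + suc b) (σ-even (suc t)) (σ-odd t) ⟩
      suc (suc t) + suc (m ∸ suc t)    ≡⟨ cong suc (+-suc (suc t) _) ⟩
      suc (suc (suc t + (m ∸ suc t)))
        ≡⟨ cong (λ z → suc (suc z)) (m+[n∸m]≡n (1+n≤m⇐1+n*2≤m t (<⇒≤ (<-trans (n<1+n _) x⁺<m)))) ⟩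
      1 + suc m                        ≡⟨ cong (_+ suc m) ([1+n*2]%2≡1 t) ⟨
      suc (t * 2) % 2 + suc m          ∎
      where open ≡-Reasoning

  ℓ-wrap : ∀ a k → suc ((a + k) * 2) < m → ℓ (a * 2) + ℓ (suc ((a + k) * 2)) + k ≡ suc m
  ℓ-wrap a k bound = begin
    ℓ (a * 2) + ℓ (suc ((a + k) * 2)) + k
      ≡⟨ cong₂ (λ p q → suc p + suc q + k) (σ-even a) (σ-odd (a + k)) ⟩
    suc a + suc (m ∸ suc (a + k)) + k
      ≡⟨ rearrange a (m ∸ suc (a + k)) k ⟩
    suc (m ∸ suc (a + k) + suc (a + k))
      ≡⟨ cong suc (m∸n+n≡m (1+n≤m⇐1+n*2≤m (a + k) (<⇒≤ bound))) ⟩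
    suc m ∎
    where
    open ≡-Reasoning
    rearrange : ∀ a u k → suc a + suc u + k ≡ suc (u + suc (a + k))
    rearrange = solve-∀

module _ (r k : ℕ) where

  private
    K n m : ℕ
    K = suc (suc k)
    n = K * 2
    m = r * n

    G : Graph
    G = rC r n

  open Zigzag m (r * K) (sym (*-assoc r K 2))

  zigzagLabeling : Labeling G
  zigzagLabeling = zigzag

  private
    w : Fin (r * n) → ℕ
    w = weight G zigzagLabeling

    label-zigzag : ∀ {e x} → toℕ e ≡ x → label G zigzagLabeling e ≡ ℓ x
    label-zigzag {e} toℕe≡x = trans (ℓ-zigzag e) (cong ℓ toℕe≡x)

    offset : Fin r → ℕ
    offset i = toℕ i * K

    toℕ-combine-rC : ∀ i (j : Fin n) → toℕ (combine i j) ≡ offset i * 2 + toℕ j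
    toℕ-combine-rC i j = trans (toℕ-combine i j)
      (cong (_+ toℕ j) (trans (*-comm n (toℕ i)) (sym (*-assoc (toℕ i) K 2))))

  zigzag-weight-zero : ∀ i → weight G zigzagLabeling (combine i zero) ≡ m ∸ k
  zigzag-weight-zero i = trans (sym (m+n∸n≡m (w (combine i zero)) (suc k))) (cong (_∸ suc k) (begin
    w (combine i zero) + suc k
      ≡⟨ cong (_+ suc k) (weight-rC zigzagLabeling i zero) ⟩
    ℓ′ (combine i zero) + ℓ′ (combine i last) + suc k
      ≡⟨ cong₂ (λ x y → x + y + suc k) (label-zigzag toℕ-first) (label-zigzag toℕ-last) ⟩
    ℓ (a * 2) + ℓ (suc ((a + suc k) * 2)) + suc k
      ≡⟨ ℓ-wrap a (suc k) (subst (_< m) toℕ-last (toℕ<n _)) ⟩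
    suc m ∎))
    where
    open ≡-Reasoning
    ℓ′ = label G zigzagLabeling
    a = offset i
    last = fromℕ (suc (suc k * 2))
    toℕ-first : toℕ (combine i zero) ≡ a * 2
    toℕ-first = trans (toℕ-combine-rC i zero) (+-identityʳ _)
    toℕ-last : toℕ (combine i last) ≡ suc ((a + suc k) * 2)
    toℕ-last = begin
      toℕ (combine i last)         ≡⟨ toℕ-combine-rC i last ⟩
      a * 2 + toℕ last             ≡⟨ cong (a * 2 +_) (toℕ-fromℕ _) ⟩
      a * 2 + suc (suc k * 2)      ≡⟨ +-suc (a * 2) _ ⟩
      suc (a * 2 + suc k * 2)      ≡⟨ cong suc (*-distribʳ-+ 2 a (suc k)) ⟨
      suc ((a + suc k) * 2)        ∎

  zigzag-weight-suc : ∀ i (y : Fin (suc (suc k * 2))) →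
                      weight G zigzagLabeling (combine i (suc y)) ≡ toℕ y % 2 + suc m
  zigzag-weight-suc i y = begin
    w (combine i (suc y))
      ≡⟨ weight-rC zigzagLabeling i (suc y) ⟩
    ℓ′ (combine i (suc y)) + ℓ′ (combine i (inject₁ y))
      ≡⟨ cong₂ _+_ (label-zigzag toℕ-next) (label-zigzag toℕ-this) ⟩
    ℓ (suc x) + ℓ x
      ≡⟨ ℓ-consecutive x (subst (_< m) toℕ-next (toℕ<n _)) ⟩
    x % 2 + suc m
      ≡⟨ cong (_+ suc m) x%2≡y%2 ⟩
    toℕ y % 2 + suc m ∎
    where
    open ≡-Reasoning
    ℓ′ = label G zigzagLabeling
    a = offset i
    x = a * 2 + toℕ y
    toℕ-next : toℕ (combine i (suc y)) ≡ suc x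
    toℕ-next = trans (toℕ-combine-rC i (suc y)) (+-suc (a * 2) (toℕ y))
    toℕ-this : toℕ (combine i (inject₁ y)) ≡ x
    toℕ-this = trans (toℕ-combine-rC i (inject₁ y)) (cong (a * 2 +_) (toℕ-inject₁ y))
    x%2≡y%2 : x % 2 ≡ toℕ y % 2
    x%2≡y%2 = trans (cong (_% 2) (+-comm (a * 2) (toℕ y))) ([m+kn]%n≡m%n (toℕ y) a 2)

  private
    m∸k<z+1+m : ∀ z → m ∸ k < z + suc m
    m∸k<z+1+m z = ≤-<-trans (m∸n≤m m k) (m≤n+m (suc m) z)

    zigzag-weight-prev≢ : ∀ (i : Fin r) (j : Fin n) → w (combine i (prev j)) ≢ w (combine i j)
    zigzag-weight-prev≢ i zero eq =
      <⇒≢ (m∸k<z+1+m _) (trans (sym (zigzag-weight-zero i)) (trans (sym eq) (zigzag-weight-suc i _)))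
    zigzag-weight-prev≢ i (suc zero) eq =
      <⇒≢ (m∸k<z+1+m 0) (trans (sym (zigzag-weight-zero i)) (trans eq (zigzag-weight-suc i zero)))
    zigzag-weight-prev≢ i (suc (suc y)) eq = n%2≢[1+n]%2 (toℕ y) (begin
      toℕ y % 2            ≡⟨ cong (_% 2) (toℕ-inject₁ y) ⟨
      toℕ (inject₁ y) % 2  ≡⟨ +-cancelʳ-≡ (suc m) _ _ (begin
        toℕ (inject₁ y) % 2 + suc m    ≡⟨ zigzag-weight-suc i (inject₁ y) ⟨
        w (combine i (suc (inject₁ y))) ≡⟨ eq ⟩
        w (combine i (suc (suc y)))    ≡⟨ zigzag-weight-suc i (suc y) ⟩
        toℕ (suc y) % 2 + suc m        ∎) ⟩
      suc (toℕ y) % 2      ∎)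
      where open ≡-Reasoning

  zigzag-antimagic : IsLocalAntimagic G zigzagLabeling
  zigzag-antimagic e with combine-surjective {r} {n} e
  ... | i , j , refl = λ eq → zigzag-weight-prev≢ i (cycNext j) (begin
    w (combine i (prev (cycNext j)))  ≡⟨ cong (w ∘ combine i) (prev-cycNext j) ⟩
    w (combine i j)                   ≡⟨ cong (w ∘ proj₁) (ends-rC i j) ⟨
    w (proj₁ (ends G (combine i j)))  ≡⟨ eq ⟩
    w (proj₂ (ends G (combine i j)))  ≡⟨ cong (w ∘ proj₂) (ends-rC i j) ⟩
    w (combine i (cycNext j))         ∎)
    where open ≡-Reasoning

  zigzag-weights : ∀ v → weight G zigzagLabeling v ∈ (m ∸ k ∷ suc m ∷ suc (suc m) ∷ [])
  zigzag-weights v with combine-surjective {r} {n} v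
  ... | i , zero , refl = here (zigzag-weight-zero i)
  ... | i , suc y , refl with toℕ y % 2 | m%n<n (toℕ y) 2 | zigzag-weight-suc i y
  ...   | 0           | _              | w≡ = there (here w≡)
  ...   | 1           | _              | w≡ = there (there (here w≡))
  ...   | suc (suc _) | s≤s (s≤s ())   | _

mainTheorem2 : (r n : ℕ) → 1 ≤ r → 4 ≤ n → 2 ∣ n →
    LocalAntimagic (rC r n) × ChiLa≡ (rC r n) 3
mainTheorem2 (suc r) .(1 * 2) _ (s≤s (s≤s ())) (divides 1 refl)
mainTheorem2 (suc r) .(suc (suc k) * 2) _ _ (divides (suc (suc k)) refl) =
  (f , antimagic) , (f , antimagic , ≤-antisym at-most-3 (at-least-3 f antimagic)) , at-least-3
  where
  f = zigzagLabeling (suc r) k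
  antimagic = zigzag-antimagic (suc r) k
  at-least-3 = 3≤numWeights-rC r (suc k)
  at-most-3 = numWeights≤length (rC (suc r) (suc (suc k) * 2)) f _ (zigzag-weights (suc r) k)
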